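{- Let $\alpha, k \geq 1$ be integers and $n = 2\alpha(\alpha+4)k + 2\alpha + 5$. The subset \[ S = \{ \pm(2\alpha\ell + 1) : 0 \leq \ell \leq k \} \subset \mathbb{Z}_n \] satisfies $\mathcal{R}_{2\alpha+2}(S) = \mathbb{Z}_n \setminus (S \cup \{0\})$ and $0 \notin (2\alpha+3)S$.
   Context: $\mathbb{Z}_n$ is the cyclic group of integers modulo $n$. For $S \subseteq \mathbb{Z}_n$ and an integer $m \geq 1$, $mS = \{s_1 + \dots + s_m : s_i \in S\}$. For an integer $m\ge 1$, $\mathcal{R}_m(S) = \{ s_1 + \dots + s_m : s_i \in S \text{ and } s_i + s_{i+1} + \dots + s_j \neq 0 \text{ for all } 1 \leq i < j \leq m\}$, the set of $m$-fold sums admitting a representation in which no sum of consecutive terms $s_i+\dots+s_j$ ($i<j$) is $0$ in $\mathbb{Z}_n$. -}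

module Defs where

open import Data.Nat using (ℕ; zero; suc; _+_; _*_; _≤_; NonZero)
open import Data.Nat.DivMod using (_%_)
open import Data.Fin using (Fin; toℕ; fromℕ<)
open import Data.Nat.DivMod using (m%n<n)
open import Data.List using (List; []; _∷_; foldr; length; take; drop; map)
open import Data.List.Relation.Unary.All using (All)
open import Data.Product using (Σ; ∃; _×_; _,_)
open import Data.Sum using (_⊎_)
open import Relation.Binary.PropositionalEquality using (_≡_)
open import Relation.Nullary using (¬_)

[_]_ : (a n : ℕ) → .{{NonZero n}} → Fin n
[ a ] n = fromℕ< (m%n<n a n)

module Zn (n : ℕ) .{{_ : NonZero n}} where

  0ₙ : Fin n
  0ₙ = [ 0 ] n

  _+ₙ_ : Fin n → Fin n → Fin n
  x +ₙ y = [ toℕ x + toℕ y ] n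

  open import Data.Nat using (_∸_)
  -ₙ_ : Fin n → Fin n
  -ₙ x = [ n ∸ toℕ x ] n

  sumₙ : List (Fin n) → Fin n
  sumₙ = foldr _+ₙ_ 0ₙ

  Subset : Set₁
  Subset = Fin n → Set

  _·_ : ℕ → Subset → Subset
  (m · S) x = Σ (List (Fin n)) λ s → length s ≡ m × All S s × sumₙ s ≡ x

  -- every block of consecutive terms s_i + ... + s_j with i < j is nonzero
  -- (a block of length ℓ ≥ 2 starting at position i is  take ℓ (drop i s))
  NoZeroBlock : List (Fin n) → Set
  NoZeroBlock s = ∀ (i ℓ : ℕ) → 2 ≤ ℓ → i + ℓ ≤ length s →
                  ¬ (sumₙ (take ℓ (drop i s)) ≡ 0ₙ)

  ℛ : ℕ → Subset → Subset
  ℛ m S x = Σ (List (Fin n)) λ s →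
              length s ≡ m × All S s × NoZeroBlock s × sumₙ s ≡ x

-- n = 2α(α+4)k + 2α + 5, written as suc (2α(α+4)k + 2α + 4) so that
-- NonZero n holds by instance search (equal to 2α(α+4)k+2α+5 by +-suc).
nOf : ℕ → ℕ → ℕ
nOf α k = suc (2 * α * (α + 4) * k + 2 * α + 4)

-- Represent residues by 0, …, n - 1.  A list of 2α + 3 elements of S with p terms 2αℓ + 1
-- and q terms -(2αℓ + 1) sums to P - N (mod n), where P = 2α Lp + p and N = 2α Lq + q.
-- Both lie below 2n and P + N is odd, so a zero sum forces P = N + n up to symmetry:
-- impossible by size when p ≤ α + 4, and modulo 2α otherwise.  Appending -x turns an
-- x ∈ S ∩ ℛ_{2α+2}(S) into such a zero sum.  Conversely, as S = -S it suffices to reach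
-- the even residues 2h ∉ -S, as q copies of -1 followed by p terms 2αℓᵢ + 1 (q + p = 2α + 2)
-- whose first term exceeds q and which sum to less than n; then no block sums to 0.

module Submission where

open import Defs
open import Data.Empty using (⊥; ⊥-elim)
open import Data.Fin using (Fin; toℕ)
open import Data.Fin.Properties using (toℕ-fromℕ<; toℕ-injective; toℕ<n)
open import Data.List using (List; []; _∷_; length; take; drop; map; replicate; _++_)
open import Data.List.Properties using (take-map; drop-map; length-map; length-++; length-replicate; map-++; map-replicate; take-all)
open import Data.List.Relation.Unary.All as All using (All; []; _∷_)
open import Data.List.Relation.Unary.All.Properties using (take⁺; map⁺; ++⁺; replicate⁺)
open import Data.Nat
open import Data.Nat.DivMod
open import Data.Nat.Divisibility using (_∣_; divides; m%n≡0⇒n∣m; ∣m+n∣m⇒∣n; n∣m*n; >⇒∤)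
open import Data.Nat.ListAction using (sum)
open import Data.Nat.ListAction.Properties using (sum-++)
open import Data.Nat.Properties
open import Data.Nat.Tactic.RingSolver using (solve-∀)
open import Data.Product using (Σ; _×_; _,_; proj₁; proj₂)
open import Data.Sum using (_⊎_; inj₁; inj₂)
open import Function.Bundles using (_⇔_; mk⇔)
open import Relation.Binary.Definitions using (tri<; tri≈; tri>)
open import Relation.Binary.PropositionalEquality hiding ([_])
open import Relation.Nullary using (¬_)
open import Relation.Nullary.Decidable using (yes; no)

sum-replicate : ∀ q x → sum (replicate q x) ≡ q * x
sum-replicate zero    x = refl
sum-replicate (suc q) x = cong (x +_) (sum-replicate q x)

take-replicate-++ : ∀ {A : Set} {x : A} {u} ℓ q → ℓ ≤ q → take ℓ (replicate q x ++ u) ≡ replicate ℓ x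
take-replicate-++ zero    q       _         = refl
take-replicate-++ (suc ℓ) (suc q) (s≤s ℓ≤q) = cong (_ ∷_) (take-replicate-++ ℓ q ℓ≤q)

take-+-replicate-++ : ∀ {A : Set} {x : A} {u} q j → take (q + j) (replicate q x ++ u) ≡ replicate q x ++ take j u
take-+-replicate-++ zero    j = refl
take-+-replicate-++ (suc q) j = cong (_ ∷_) (take-+-replicate-++ q j)

sum-take≤sum : ∀ j u → sum (take j u) ≤ sum u
sum-take≤sum zero    u       = z≤n
sum-take≤sum (suc j) []      = z≤n
sum-take≤sum (suc j) (a ∷ u) = +-monoʳ-≤ a (sum-take≤sum j u)

head<sum-take : ∀ {q} j u → All (q <_) (take 1 u) → 1 ≤ j → j ≤ length u → q < sum (take j u)
head<sum-take (suc j) (a ∷ u) (q<a ∷ []) _ _ = ≤-trans q<a (m≤m+n a _)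

≤-via : ∀ {a b} d → a + d ≡ b → a ≤ b
≤-via {a} d eq = subst (a ≤_) eq (m≤m+n a d)

c*a+x≢c*b+y : ∀ c a b {x y} → y < x → x < c + y → c * a + x ≢ c * b + y
c*a+x≢c*b+y c a b {x} {y} y<x x<c+y eq with <-cmp a b
... | tri< a<b _ _ = <⇒≢ (begin-strict
  c * a + x        <⟨ +-monoʳ-< (c * a) x<c+y ⟩
  c * a + (c + y)  ≡⟨ regroup c a y ⟩
  c * (1 + a) + y  ≤⟨ +-monoˡ-≤ y (*-monoʳ-≤ c a<b) ⟩
  c * b + y        ∎) eq
  where
  open ≤-Reasoning
  regroup : ∀ c a y → c * a + (c + y) ≡ c * (1 + a) + y
  regroup = solve-∀
... | tri≈ _ refl _ = <⇒≢ y<x (sym (+-cancelˡ-≡ (c * a) x y eq))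
... | tri> _ _ b<a = <⇒≢ (begin-strict
  c * b + y  <⟨ +-monoʳ-< (c * b) y<x ⟩
  c * b + x  ≤⟨ +-monoˡ-≤ x (*-monoʳ-≤ c (<⇒≤ b<a)) ⟩
  c * a + x  ∎) (sym eq)
  where open ≤-Reasoning

wraps-once : ∀ {n a b i j} → a + i * n ≡ b + j * n → i < j → a < n + n → a ≡ b + n
wraps-once {n} {a} {b} {i} eq i<j a<2n with m≤n⇒∃[o]m+o≡n i<j
... | zero   , refl = +-cancelʳ-≡ (i * n) a (b + n) (trans eq (regroup n b i))
  where
  regroup : ∀ n b i → b + (1 + i + 0) * n ≡ b + n + i * n
  regroup = solve-∀
... | suc r , refl = ⊥-elim (<⇒≱ a<2n (≤-via (b + r * n) (+-cancelʳ-≡ (i * n) _ a (trans (regroup n b i r) (sym eq)))))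
  where
  regroup : ∀ n b i r → n + n + (b + r * n) + i * n ≡ b + (1 + i + suc r) * n
  regroup = solve-∀

≡-mod-below-2n : ∀ {n a b i j} → a + i * n ≡ b + j * n → a < n + n → b < n + n →
  a ≡ b ⊎ a ≡ b + n ⊎ b ≡ a + n
≡-mod-below-2n {i = i} {j} eq a<2n b<2n with <-cmp i j
... | tri< i<j _ _ = inj₂ (inj₁ (wraps-once eq i<j a<2n))
... | tri≈ _ refl _ = inj₁ (+-cancelʳ-≡ (i * _) _ _ eq)
... | tri> _ _ j<i = inj₂ (inj₂ (wraps-once (sym eq) j<i b<2n))

parts : ℕ → ℕ → ℕ → List ℕ
parts k zero    L = []
parts k (suc p) L = L ⊓ k ∷ parts k p (L ∸ k)

length-parts : ∀ k p L → length (parts k p L) ≡ p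
length-parts k zero    L = refl
length-parts k (suc p) L = cong suc (length-parts k p (L ∸ k))

parts-≤ : ∀ k p L → All (_≤ k) (parts k p L)
parts-≤ k zero    L = []
parts-≤ k (suc p) L = m⊓n≤n L k ∷ parts-≤ k p (L ∸ k)

sum-parts : ∀ k p L → L ≤ p * k → sum (parts k p L) ≡ L
sum-parts k zero    L L≤0 = sym (n≤0⇒n≡0 L≤0)
sum-parts k (suc p) L L≤ with L ≤? k
... | yes L≤k = begin
  L ⊓ k + sum (parts k p (L ∸ k))  ≡⟨ cong₂ _+_ (m≤n⇒m⊓n≡m L≤k) (cong (λ z → sum (parts k p z)) L∸k≡0) ⟩
  L + sum (parts k p 0)            ≡⟨ cong (L +_) (sum-parts k p 0 z≤n) ⟩
  L + 0                            ≡⟨ +-identityʳ L ⟩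
  L                                ∎
  where
  open ≡-Reasoning
  L∸k≡0 : L ∸ k ≡ 0
  L∸k≡0 = m≤n⇒m∸n≡0 L≤k
... | no L≰k = begin
  L ⊓ k + sum (parts k p (L ∸ k))  ≡⟨ cong₂ _+_ (m≥n⇒m⊓n≡n k≤L) (sum-parts k p (L ∸ k) L∸k≤) ⟩
  k + (L ∸ k)                      ≡⟨ m+[n∸m]≡n k≤L ⟩
  L                                ∎
  where
  open ≡-Reasoning
  k≤L : k ≤ L
  k≤L = <⇒≤ (≰⇒> L≰k)
  L∸k≤ : L ∸ k ≤ p * k
  L∸k≤ = subst (L ∸ k ≤_) (m+n∸m≡n k (p * k)) (∸-monoˡ-≤ k L≤)

module Residues (n' : ℕ) where

  n : ℕ
  n = suc n'

  open Zn n
  open ≡-Reasoning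

  %-absorbˡ : ∀ a b → (a % n + b) % n ≡ (a + b) % n
  %-absorbˡ a b = begin
    (a % n + b) % n          ≡⟨ %-distribˡ-+ (a % n) b n ⟩
    (a % n % n + b % n) % n  ≡⟨ cong (λ z → (z + b % n) % n) (m%n%n≡m%n a n) ⟩
    (a % n + b % n) % n      ≡⟨ %-distribˡ-+ a b n ⟨
    (a + b) % n              ∎

  %-absorbʳ : ∀ a b → (a + b % n) % n ≡ (a + b) % n
  %-absorbʳ a b = begin
    (a + b % n) % n  ≡⟨ cong (_% n) (+-comm a (b % n)) ⟩
    (b % n + a) % n  ≡⟨ %-absorbˡ b a ⟩
    (b + a) % n      ≡⟨ cong (_% n) (+-comm b a) ⟩
    (a + b) % n      ∎

  %-inverse-unique : ∀ a b c → (a + c) % n ≡ 0 → (b + c) % n ≡ 0 → a % n ≡ b % n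
  %-inverse-unique a b c a+c b+c = begin
    a % n                  ≡⟨ cong (_% n) (+-identityʳ a) ⟨
    (a + 0) % n            ≡⟨ cong (λ z → (a + z) % n) c+b ⟨
    (a + (c + b) % n) % n  ≡⟨ %-absorbʳ a (c + b) ⟩
    (a + (c + b)) % n      ≡⟨ cong (_% n) (+-assoc a c b) ⟨
    (a + c + b) % n        ≡⟨ %-absorbˡ (a + c) b ⟨
    ((a + c) % n + b) % n  ≡⟨ cong (λ z → (z + b) % n) a+c ⟩
    b % n                  ∎
    where
    c+b : (c + b) % n ≡ 0
    c+b = trans (cong (_% n) (+-comm c b)) b+c

  toℕ-[] : ∀ a → toℕ ([ a ] n) ≡ a % n
  toℕ-[] a = toℕ-fromℕ< (m%n<n a n)

  toℕ-[]-< : ∀ {a} → a < n → toℕ ([ a ] n) ≡ a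
  toℕ-[]-< {a} a<n = trans (toℕ-[] a) (m<n⇒m%n≡m a<n)

  toℕ-%-injective : ∀ {x y : Fin n} → toℕ x % n ≡ toℕ y % n → x ≡ y
  toℕ-%-injective {x} {y} eq = toℕ-injective (begin
    toℕ x      ≡⟨ m<n⇒m%n≡m (toℕ<n x) ⟨
    toℕ x % n  ≡⟨ eq ⟩
    toℕ y % n  ≡⟨ m<n⇒m%n≡m (toℕ<n y) ⟩
    toℕ y      ∎)

  toℕ-+ₙ : ∀ x y → toℕ (x +ₙ y) ≡ (toℕ x + toℕ y) % n
  toℕ-+ₙ x y = toℕ-[] (toℕ x + toℕ y)

  toℕ-sumₙ : ∀ s → toℕ (sumₙ s) ≡ sum (map toℕ s) % n
  toℕ-sumₙ []      = refl
  toℕ-sumₙ (x ∷ s) = begin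
    toℕ (x +ₙ sumₙ s)                    ≡⟨ toℕ-+ₙ x (sumₙ s) ⟩
    (toℕ x + toℕ (sumₙ s)) % n           ≡⟨ cong (λ z → (toℕ x + z) % n) (toℕ-sumₙ s) ⟩
    (toℕ x + sum (map toℕ s) % n) % n    ≡⟨ %-absorbʳ (toℕ x) _ ⟩
    (toℕ x + sum (map toℕ s)) % n        ∎

  toℕ-neg : ∀ x → 0 < toℕ x → toℕ (-ₙ x) ≡ n ∸ toℕ x
  toℕ-neg x 0<x = toℕ-[]-< (∸-monoʳ-< 0<x (<⇒≤ (toℕ<n x)))

  toℕ-inverseˡ : ∀ x → (toℕ (-ₙ x) + toℕ x) % n ≡ 0
  toℕ-inverseˡ x = begin
    (toℕ (-ₙ x) + toℕ x) % n       ≡⟨ cong (λ z → (z + toℕ x) % n) (toℕ-[] (n ∸ toℕ x)) ⟩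
    ((n ∸ toℕ x) % n + toℕ x) % n  ≡⟨ %-absorbˡ (n ∸ toℕ x) (toℕ x) ⟩
    (n ∸ toℕ x + toℕ x) % n        ≡⟨ cong (_% n) (m∸n+n≡m (<⇒≤ (toℕ<n x))) ⟩
    n % n                          ≡⟨ n%n≡0 n ⟩
    0                              ∎

  -ₙ-inverseˡ : ∀ x → (-ₙ x) +ₙ x ≡ 0ₙ
  -ₙ-inverseˡ x = toℕ-injective (trans (toℕ-+ₙ (-ₙ x) x) (toℕ-inverseˡ x))

  ≡-neg : ∀ x y → (toℕ y + toℕ x) % n ≡ 0 → y ≡ -ₙ x
  ≡-neg x y y+x = toℕ-%-injective (%-inverse-unique (toℕ y) (toℕ (-ₙ x)) (toℕ x) y+x (toℕ-inverseˡ x))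

  -ₙ-involutive : ∀ x → -ₙ (-ₙ x) ≡ x
  -ₙ-involutive x = sym (≡-neg (-ₙ x) x (trans (cong (_% n) (+-comm (toℕ x) _)) (toℕ-inverseˡ x)))

  -ₙ-zero : -ₙ 0ₙ ≡ 0ₙ
  -ₙ-zero = sym (≡-neg 0ₙ 0ₙ refl)

  -ₙ-distrib-+ₙ : ∀ x y → -ₙ (x +ₙ y) ≡ (-ₙ x) +ₙ (-ₙ y)
  -ₙ-distrib-+ₙ x y = sym (≡-neg (x +ₙ y) ((-ₙ x) +ₙ (-ₙ y)) (begin
    (toℕ ((-ₙ x) +ₙ (-ₙ y)) + toℕ (x +ₙ y)) % n  ≡⟨ cong₂ (λ a b → (a + b) % n) (toℕ-+ₙ (-ₙ x) (-ₙ y)) (toℕ-+ₙ x y) ⟩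
    ((x' + y') % n + (X + Y) % n) % n  ≡⟨ %-absorbˡ (x' + y') _ ⟩
    (x' + y' + (X + Y) % n) % n        ≡⟨ %-absorbʳ (x' + y') (X + Y) ⟩
    (x' + y' + (X + Y)) % n            ≡⟨ cong (_% n) (shuffle x' y' X Y) ⟩
    (x' + X + (y' + Y)) % n            ≡⟨ %-absorbˡ (x' + X) (y' + Y) ⟨
    ((x' + X) % n + (y' + Y)) % n      ≡⟨ cong (λ z → (z + (y' + Y)) % n) (toℕ-inverseˡ x) ⟩
    (y' + Y) % n                       ≡⟨ toℕ-inverseˡ y ⟩
    0                                  ∎))
    where
    X Y x' y' : ℕ
    X = toℕ x
    Y = toℕ y
    x' = toℕ (-ₙ x)
    y' = toℕ (-ₙ y)
    shuffle : ∀ a b c d → a + b + (c + d) ≡ a + c + (b + d)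
    shuffle = solve-∀

  sumₙ-map-neg : ∀ s → sumₙ (map -ₙ_ s) ≡ -ₙ (sumₙ s)
  sumₙ-map-neg []      = sym -ₙ-zero
  sumₙ-map-neg (x ∷ s) = trans (cong ((-ₙ x) +ₙ_) (sumₙ-map-neg s)) (sym (-ₙ-distrib-+ₙ x (sumₙ s)))

  neg-NoZeroBlock : ∀ s → NoZeroBlock s → NoZeroBlock (map -ₙ_ s)
  neg-NoZeroBlock s nz i ℓ 2≤ℓ i+ℓ≤ block≡0 = nz i ℓ 2≤ℓ (subst (i + ℓ ≤_) (length-map -ₙ_ s) i+ℓ≤) (begin
    sumₙ block                   ≡⟨ -ₙ-involutive (sumₙ block) ⟨
    -ₙ (-ₙ (sumₙ block))         ≡⟨ cong -ₙ_ (sumₙ-map-neg block) ⟨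
    -ₙ (sumₙ (map -ₙ_ block))    ≡⟨ cong (λ z → -ₙ (sumₙ z)) map-block ⟨
    -ₙ (sumₙ (take ℓ (drop i (map -ₙ_ s))))  ≡⟨ cong -ₙ_ block≡0 ⟩
    -ₙ 0ₙ                        ≡⟨ -ₙ-zero ⟩
    0ₙ                           ∎)
    where
    block : List (Fin n)
    block = take ℓ (drop i s)
    map-block : take ℓ (drop i (map -ₙ_ s)) ≡ map -ₙ_ block
    map-block = trans (cong (take ℓ) (drop-map i s)) (take-map ℓ (drop i s))

  ℛ-neg : ∀ {m S x} → (∀ y → S y → S (-ₙ y)) → ℛ m S x → ℛ m S (-ₙ x)
  ℛ-neg S-neg (s , len , all , nz , sum≡x) =
    map -ₙ_ s ,
    trans (length-map -ₙ_ s) len ,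
    map⁺ (All.map (S-neg _) all) ,
    neg-NoZeroBlock s nz ,
    trans (sumₙ-map-neg s) (cong -ₙ_ sum≡x)

  NoDivisibleBlock : List ℕ → Set
  NoDivisibleBlock w = ∀ i ℓ → 2 ≤ ℓ → i + ℓ ≤ length w → ¬ (n ∣ sum (take ℓ (drop i w)))

  NoDivisibleBlock⇒NoZeroBlock : ∀ s → NoDivisibleBlock (map toℕ s) → NoZeroBlock s
  NoDivisibleBlock⇒NoZeroBlock s ndb i ℓ 2≤ℓ i+ℓ≤ block≡0 =
    ndb i ℓ 2≤ℓ (subst (i + ℓ ≤_) (sym (length-map toℕ s)) i+ℓ≤) (subst (n ∣_) block-sum n∣block)
    where
    block : List (Fin n)
    block = take ℓ (drop i s)
    n∣block : n ∣ sum (map toℕ block)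
    n∣block = m%n≡0⇒n∣m _ n (trans (sym (toℕ-sumₙ block)) (cong toℕ block≡0))
    block-sum : sum (map toℕ block) ≡ sum (take ℓ (drop i (map toℕ s)))
    block-sum = cong sum (sym (trans (cong (take ℓ) (drop-map i s)) (take-map ℓ (drop i s))))

  ∤-between : ∀ {r} → 0 < r → r < n → ¬ (n ∣ r)
  ∤-between {suc r} _ r<n = >⇒∤ r<n

  -- n' represents -1: a prefix of ℓ ≤ q terms sums to -ℓ, a longer one to (a prefix sum of u) - q.
  minusOnes++-prefix : ∀ q u → q < n → sum u < n → All (q <_) (take 1 u) →
    ∀ ℓ → 2 ≤ ℓ → ℓ ≤ length (replicate q n' ++ u) → ¬ (n ∣ sum (take ℓ (replicate q n' ++ u)))
  minusOnes++-prefix q u q<n Σu<n head ℓ 2≤ℓ ℓ≤len n∣prefix with ≤-<-connex ℓ q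
  ... | inj₁ ℓ≤q = ∤-between (≤-trans (s≤s z≤n) 2≤ℓ) (≤-<-trans ℓ≤q q<n) (∣m+n∣m⇒∣n n∣ℓ*n'+ℓ n∣ℓ*n')
    where
    n∣ℓ*n' : n ∣ ℓ * n'
    n∣ℓ*n' = subst (n ∣_) (trans (cong sum (take-replicate-++ ℓ q ℓ≤q)) (sum-replicate ℓ n')) n∣prefix
    n∣ℓ*n'+ℓ : n ∣ ℓ * n' + ℓ
    n∣ℓ*n'+ℓ = subst (n ∣_) (trans (*-suc ℓ n') (+-comm ℓ (ℓ * n'))) (n∣m*n ℓ)
  ... | inj₂ q<ℓ = ∤-between (m<n⇒0<n∸m q<σ) (≤-<-trans (m∸n≤m σ q) (≤-<-trans (sum-take≤sum j u) Σu<n)) n∣σ∸q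
    where
    j : ℕ
    j = ℓ ∸ q
    q+j≡ℓ : q + j ≡ ℓ
    q+j≡ℓ = m+[n∸m]≡n (<⇒≤ q<ℓ)
    σ : ℕ
    σ = sum (take j u)
    j≤len : j ≤ length u
    j≤len = +-cancelˡ-≤ q j (length u) (subst₂ _≤_ (sym q+j≡ℓ) (trans (length-++ (replicate q n')) (cong (_+ length u) (length-replicate q))) ℓ≤len)
    q<σ : q < σ
    q<σ = head<sum-take j u head (m<n⇒0<n∸m q<ℓ) j≤len
    prefix-sum : sum (take ℓ (replicate q n' ++ u)) ≡ q * n + (σ ∸ q)
    prefix-sum = begin
      sum (take ℓ (replicate q n' ++ u))        ≡⟨ cong (λ z → sum (take z (replicate q n' ++ u))) q+j≡ℓ ⟨
      sum (take (q + j) (replicate q n' ++ u))  ≡⟨ cong sum (take-+-replicate-++ q j) ⟩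
      sum (replicate q n' ++ take j u)          ≡⟨ sum-++ (replicate q n') (take j u) ⟩
      sum (replicate q n') + σ                  ≡⟨ cong (_+ σ) (sum-replicate q n') ⟩
      q * n' + σ                                ≡⟨ cong (q * n' +_) (m+[n∸m]≡n (<⇒≤ q<σ)) ⟨
      q * n' + (q + (σ ∸ q))                    ≡⟨ regroup q n' (σ ∸ q) ⟩
      q * n + (σ ∸ q)                           ∎
      where
      regroup : ∀ q n' r → q * n' + (q + r) ≡ q * suc n' + r
      regroup = solve-∀
    n∣σ∸q : n ∣ σ ∸ q
    n∣σ∸q = ∣m+n∣m⇒∣n (subst (n ∣_) prefix-sum n∣prefix) (n∣m*n q)

  minusOnes++-NoDivisibleBlock : ∀ q u → q < n → All (1 ≤_) u → sum u < n → All (q <_) (take 1 u) →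
    NoDivisibleBlock (replicate q n' ++ u)
  minusOnes++-NoDivisibleBlock q u q<n pos Σu<n head zero = minusOnes++-prefix q u q<n Σu<n head
  minusOnes++-NoDivisibleBlock (suc q) u q<n pos Σu<n head (suc i) ℓ 2≤ℓ i+ℓ≤ =
    minusOnes++-NoDivisibleBlock q u (<-trans (n<1+n q) q<n) pos Σu<n (All.map (<-trans (n<1+n q)) head) i ℓ 2≤ℓ (≤-pred i+ℓ≤)
  minusOnes++-NoDivisibleBlock zero (a ∷ u) q<n (_ ∷ pos) Σu<n head (suc i) ℓ 2≤ℓ i+ℓ≤ =
    minusOnes++-NoDivisibleBlock zero u q<n pos (≤-<-trans (m≤n+m (sum u) a) Σu<n) (take⁺ 1 pos) i ℓ 2≤ℓ (≤-pred i+ℓ≤)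

module Setting (α k : ℕ) where

  n' : ℕ
  n' = 2 * α * (α + 4) * k + 2 * α + 4

  open Residues n'
  open Zn n

  f : ℕ → ℕ
  f ℓ = 2 * α * ℓ + 1

  S : Subset
  S x = Σ ℕ λ ℓ → ℓ ≤ k × ((x ≡ [ f ℓ ] n) ⊎ (x ≡ -ₙ ([ f ℓ ] n)))

  weight : ℕ → ℕ → ℕ
  weight L c = 2 * α * L + c

  f<n : ∀ {ℓ} → ℓ ≤ k → f ℓ < n
  f<n {ℓ} ℓ≤k = s≤s (≤-trans (+-monoˡ-≤ 1 (*-monoʳ-≤ (2 * α) ℓ≤k)) (≤-via (2 * α * k * (α + 3) + 2 * α + 3) (gap α k)))
    where
    gap : ∀ α k → 2 * α * k + 1 + (2 * α * k * (α + 3) + 2 * α + 3) ≡ 2 * α * (α + 4) * k + 2 * α + 4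
    gap = solve-∀

  toℕ-[f] : ∀ {ℓ} → ℓ ≤ k → toℕ ([ f ℓ ] n) ≡ f ℓ
  toℕ-[f] ℓ≤k = toℕ-[]-< (f<n ℓ≤k)

  toℕ-neg-[f] : ∀ {ℓ} → ℓ ≤ k → toℕ (-ₙ ([ f ℓ ] n)) + f ℓ ≡ n
  toℕ-neg-[f] {ℓ} ℓ≤k = begin
    toℕ (-ₙ [ f ℓ ] n) + f ℓ        ≡⟨ cong (_+ f ℓ) (toℕ-neg ([ f ℓ ] n) (subst (0 <_) (sym (toℕ-[f] ℓ≤k)) (m≤n+m 1 _))) ⟩
    n ∸ toℕ ([ f ℓ ] n) + f ℓ       ≡⟨ cong (λ z → n ∸ z + f ℓ) (toℕ-[f] ℓ≤k) ⟩
    n ∸ f ℓ + f ℓ                   ≡⟨ m∸n+n≡m (<⇒≤ (f<n ℓ≤k)) ⟩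
    n                               ∎
    where open ≡-Reasoning

  S-neg : ∀ y → S y → S (-ₙ y)
  S-neg y (ℓ , ℓ≤k , inj₁ y≡) = ℓ , ℓ≤k , inj₂ (cong -ₙ_ y≡)
  S-neg y (ℓ , ℓ≤k , inj₂ y≡) = ℓ , ℓ≤k , inj₁ (trans (cong -ₙ_ y≡) (-ₙ-involutive _))

  -- s has p terms [ f ℓ ] n and q terms -ₙ [ f ℓ ] n; the ℓ's of each kind sum to Lp and Lq.
  record Split (s : List (Fin n)) : Set where
    constructor mkSplit
    field
      p q Lp Lq  : ℕ
      p+q≡length : p + q ≡ length s
      Lp≤p*k     : Lp ≤ p * k
      Lq≤q*k     : Lq ≤ q * k
      balance    : sum (map toℕ s) + weight Lq q ≡ weight Lp p + q * n

  split : ∀ s → All S s → Split s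
  split [] [] = mkSplit 0 0 0 0 refl z≤n z≤n (sym (+-identityʳ _))
  split (y ∷ s) ((ℓ , ℓ≤k , inj₁ y≡) ∷ all) with split s all
  ... | mkSplit p q Lp Lq len Lp≤ Lq≤ bal =
    mkSplit (suc p) q (ℓ + Lp) Lq (cong suc len) (+-mono-≤ ℓ≤k Lp≤) Lq≤ (begin
      toℕ y + σ + weight Lq q        ≡⟨ cong (λ z → z + σ + weight Lq q) (trans (cong toℕ y≡) (toℕ-[f] ℓ≤k)) ⟩
      f ℓ + σ + weight Lq q          ≡⟨ +-assoc (f ℓ) σ _ ⟩
      f ℓ + (σ + weight Lq q)        ≡⟨ cong (f ℓ +_) bal ⟩
      f ℓ + (weight Lp p + q * n)    ≡⟨ regroup α ℓ Lp p (q * n) ⟩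
      weight (ℓ + Lp) (suc p) + q * n ∎)
    where
    open ≡-Reasoning
    σ : ℕ
    σ = sum (map toℕ s)
    regroup : ∀ α ℓ Lp p m → 2 * α * ℓ + 1 + (2 * α * Lp + p + m) ≡ 2 * α * (ℓ + Lp) + suc p + m
    regroup = solve-∀
  split (y ∷ s) ((ℓ , ℓ≤k , inj₂ y≡) ∷ all) with split s all
  ... | mkSplit p q Lp Lq len Lp≤ Lq≤ bal =
    mkSplit p (suc q) Lp (ℓ + Lq) (trans (+-suc p q) (cong suc len)) Lp≤ (+-mono-≤ ℓ≤k Lq≤) (begin
      toℕ y + σ + weight (ℓ + Lq) (suc q)  ≡⟨ regroup (toℕ y) σ α ℓ Lq q ⟩
      (toℕ y + f ℓ) + (σ + weight Lq q)    ≡⟨ cong₂ _+_ (trans (cong (λ z → toℕ z + f ℓ) y≡) (toℕ-neg-[f] ℓ≤k)) bal ⟩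
      n + (weight Lp p + q * n)            ≡⟨ regroup' n (weight Lp p) q ⟩
      weight Lp p + suc q * n              ∎)
    where
    open ≡-Reasoning
    σ : ℕ
    σ = sum (map toℕ s)
    regroup : ∀ y σ α ℓ Lq q → y + σ + (2 * α * (ℓ + Lq) + suc q) ≡ (y + (2 * α * ℓ + 1)) + (σ + (2 * α * Lq + q))
    regroup = solve-∀
    regroup' : ∀ n P q → n + (P + q * n) ≡ P + suc q * n
    regroup' = solve-∀

  weight<2n : ∀ {L c} → L ≤ c * k → c ≤ 2 * α + 3 → weight L c < n + n
  weight<2n {L} {c} L≤ c≤ = begin-strict
    2 * α * L + c                                   ≤⟨ +-mono-≤ (*-monoʳ-≤ (2 * α) (≤-trans L≤ (*-monoˡ-≤ k c≤))) c≤ ⟩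
    2 * α * ((2 * α + 3) * k) + (2 * α + 3)         <⟨ ≤-via (10 * α * k + 2 * α + 6) (gap α k) ⟩
    n + n                                           ∎
    where
    open ≤-Reasoning
    gap : ∀ α k → suc (2 * α * ((2 * α + 3) * k) + (2 * α + 3)) + (10 * α * k + 2 * α + 6)
                  ≡ suc (2 * α * (α + 4) * k + 2 * α + 4) + suc (2 * α * (α + 4) * k + 2 * α + 4)
    gap = solve-∀

  -- For p ≤ α + 4 the positive part is too small to wrap around; otherwise its
  -- residue p modulo 2α cannot match the residue q + 5 of the right-hand side.
  weight≢weight+n : ∀ {p q Lp Lq} → p + q ≡ 2 * α + 3 → Lp ≤ p * k → weight Lp p ≢ weight Lq q + n
  weight≢weight+n {p} {q} {Lp} {Lq} p+q Lp≤ with ≤-<-connex p (α + 4)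
  ... | inj₁ p≤α+4 = <⇒≢ (begin-strict
    2 * α * Lp + p                           ≤⟨ +-mono-≤ (*-monoʳ-≤ (2 * α) (≤-trans Lp≤ (*-monoˡ-≤ k p≤α+4))) p≤2α+3 ⟩
    2 * α * ((α + 4) * k) + (2 * α + 3)      <⟨ ≤-via 1 (gap α k) ⟩
    n                                        ≤⟨ m≤n+m n _ ⟩
    weight Lq q + n                          ∎)
    where
    open ≤-Reasoning
    p≤2α+3 : p ≤ 2 * α + 3
    p≤2α+3 = ≤-via q p+q
    gap : ∀ α k → suc (2 * α * ((α + 4) * k) + (2 * α + 3)) + 1 ≡ suc (2 * α * (α + 4) * k + 2 * α + 4)
    gap = solve-∀
  ... | inj₂ α+4<p = λ eq → c*a+x≢c*b+y (2 * α) Lp (Lq + (α + 4) * k + 1) q+5<p p<2α+q+5 (trans eq (regroup α k Lq q))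
    where
    open ≤-Reasoning
    regroup : ∀ α k Lq q → 2 * α * Lq + q + suc (2 * α * (α + 4) * k + 2 * α + 4) ≡ 2 * α * (Lq + (α + 4) * k + 1) + (q + 5)
    regroup = solve-∀
    q+5<p : q + 5 < p
    q+5<p = +-cancelʳ-< p (q + 5) p (begin-strict
      q + 5 + p                ≡⟨ +-comm (q + 5) p ⟩
      p + (q + 5)              ≡⟨ +-assoc p q 5 ⟨
      p + q + 5                ≡⟨ cong (_+ 5) p+q ⟩
      2 * α + 3 + 5            <⟨ ≤-via 1 (gap α) ⟩
      suc (α + 4) + suc (α + 4) ≤⟨ +-mono-≤ α+4<p α+4<p ⟩
      p + p                    ∎)
      where
      gap : ∀ α → suc (2 * α + 3 + 5) + 1 ≡ suc (α + 4) + suc (α + 4)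
      gap = solve-∀
    p<2α+q+5 : p < 2 * α + (q + 5)
    p<2α+q+5 = begin-strict
      p            ≤⟨ ≤-via q p+q ⟩
      2 * α + 3    <⟨ ≤-via (1 + q) (gap α q) ⟩
      2 * α + (q + 5) ∎
      where
      gap : ∀ α q → suc (2 * α + 3) + (1 + q) ≡ 2 * α + (q + 5)
      gap = solve-∀

  weight+weight-odd : ∀ {p q Lp Lq} → p + q ≡ 2 * α + 3 → weight Lp p + weight Lq q ≡ 2 * (α * (Lp + Lq) + α + 1) + 1
  weight+weight-odd {p} {q} {Lp} {Lq} p+q = begin
    2 * α * Lp + p + (2 * α * Lq + q)     ≡⟨ regroup α Lp Lq p q ⟩
    2 * α * (Lp + Lq) + (p + q)           ≡⟨ cong (2 * α * (Lp + Lq) +_) p+q ⟩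
    2 * α * (Lp + Lq) + (2 * α + 3)       ≡⟨ regroup' α (Lp + Lq) ⟩
    2 * (α * (Lp + Lq) + α + 1) + 1       ∎
    where
    open ≡-Reasoning
    regroup : ∀ α Lp Lq p q → 2 * α * Lp + p + (2 * α * Lq + q) ≡ 2 * α * (Lp + Lq) + (p + q)
    regroup = solve-∀
    regroup' : ∀ α L → 2 * α * L + (2 * α + 3) ≡ 2 * (α * L + α + 1) + 1
    regroup' = solve-∀

  weight≢weight-mod-n : ∀ {p q Lp Lq i j} → p + q ≡ 2 * α + 3 → Lp ≤ p * k → Lq ≤ q * k →
    weight Lp p + i * n ≢ weight Lq q + j * n
  weight≢weight-mod-n {p} {q} {Lp} {Lq} {i} {j} p+q Lp≤ Lq≤ eq =
    excluded (≡-mod-below-2n {n} {i = i} {j} eq (weight<2n Lp≤ (≤-via q p+q)) (weight<2n Lq≤ (≤-via p q+p)))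
    where
    q+p : q + p ≡ 2 * α + 3
    q+p = trans (+-comm q p) p+q
    P N : ℕ
    P = weight Lp p
    N = weight Lq q
    excluded : P ≡ N ⊎ P ≡ N + n ⊎ N ≡ P + n → ⊥
    excluded (inj₁ P≡N) = c*a+x≢c*b+y 2 (α * (Lp + Lq) + α + 1) P {1} {0} (s≤s z≤n) (s≤s (s≤s z≤n)) (begin
      2 * (α * (Lp + Lq) + α + 1) + 1  ≡⟨ weight+weight-odd p+q ⟨
      P + N                            ≡⟨ cong (P +_) P≡N ⟨
      P + P                            ≡⟨ double P ⟩
      2 * P + 0                        ∎)
      where
      open ≡-Reasoning
      double : ∀ P → P + P ≡ 2 * P + 0
      double = solve-∀
    excluded (inj₂ (inj₁ P≡N+n)) = weight≢weight+n p+q Lp≤ P≡N+n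
    excluded (inj₂ (inj₂ N≡P+n)) = weight≢weight+n q+p Lq≤ N≡P+n

  0∉[2α+3]S : ¬ ((2 * α + 3) · S) 0ₙ
  0∉[2α+3]S (s , len , all , sum≡0) with split s all | m%n≡0⇒n∣m (sum (map toℕ s)) n (trans (sym (toℕ-sumₙ s)) (cong toℕ sum≡0))
  ... | mkSplit p q Lp Lq p+q Lp≤ Lq≤ bal | divides t σ≡t*n =
    weight≢weight-mod-n {i = q} {t} (trans p+q len) Lp≤ Lq≤ (sym (trans (+-comm (weight Lq q) (t * n)) (trans (cong (_+ weight Lq q) (sym σ≡t*n)) bal)))

  sum-map-f : ∀ ℓs → sum (map f ℓs) ≡ weight (sum ℓs) (length ℓs)
  sum-map-f []       = sym (trans (+-identityʳ (2 * α * 0)) (*-zeroʳ (2 * α)))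
  sum-map-f (ℓ ∷ ℓs) = trans (cong (f ℓ +_) (sum-map-f ℓs)) (regroup α ℓ (sum ℓs) (length ℓs))
    where
    regroup : ∀ α ℓ L c → 2 * α * ℓ + 1 + (2 * α * L + c) ≡ 2 * α * (ℓ + L) + suc c
    regroup = solve-∀

  -- The sequence (-1)^q, f ℓ₁, …, f ℓ_p with ∑ ℓᵢ = L, of length 2α + 2 and sum T.
  record Blueprint (T : ℕ) : Set where
    constructor mkBlueprint
    field
      p q L      : ℕ
      q+p≡2α+2   : q + p ≡ 2 * α + 2
      q≤2α       : q ≤ 2 * α
      1≤L        : 1 ≤ L
      L≤p*k      : L ≤ p * k
      weight≡T+q : weight L p ≡ T + q
      weight<n   : weight L p < n

  module _ {T} (1≤k : 1 ≤ k) (bp : Blueprint T) where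
    open Blueprint bp

    -1ₙ : Fin n
    -1ₙ = -ₙ ([ f 0 ] n)

    toℕ--1ₙ : toℕ -1ₙ ≡ n'
    toℕ--1ₙ = +-cancelʳ-≡ 1 _ _ (trans (cong (toℕ -1ₙ +_) (sym f0≡1)) (trans (toℕ-neg-[f] z≤n) (+-comm 1 _)))
      where
      f0≡1 : f 0 ≡ 1
      f0≡1 = cong (_+ 1) (*-zeroʳ (2 * α))

    ℓs : List ℕ
    ℓs = parts k p L

    [f] : ℕ → Fin n
    [f] ℓ = [ f ℓ ] n

    sequence : List (Fin n)
    sequence = replicate q -1ₙ ++ map [f] ℓs

    toℕ-sequence : map toℕ sequence ≡ replicate q n' ++ map f ℓs
    toℕ-sequence = begin
      map toℕ (replicate q -1ₙ ++ map [f] ℓs)              ≡⟨ map-++ toℕ (replicate q -1ₙ) _ ⟩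
      map toℕ (replicate q -1ₙ) ++ map toℕ (map [f] ℓs)    ≡⟨ cong₂ _++_ (trans (map-replicate toℕ q -1ₙ) (cong (replicate q) toℕ--1ₙ)) (toℕ-map-[f] ℓs (parts-≤ k p L)) ⟩
      replicate q n' ++ map f ℓs                           ∎
      where
      open ≡-Reasoning
      toℕ-map-[f] : ∀ ℓs → All (_≤ k) ℓs → map toℕ (map [f] ℓs) ≡ map f ℓs
      toℕ-map-[f] []       []           = refl
      toℕ-map-[f] (ℓ ∷ ℓs) (ℓ≤k ∷ ℓs≤k) = cong₂ _∷_ (toℕ-[f] ℓ≤k) (toℕ-map-[f] ℓs ℓs≤k)

    sum-map-f-ℓs : sum (map f ℓs) ≡ weight L p
    sum-map-f-ℓs = trans (sum-map-f ℓs) (cong₂ weight (sum-parts k p L L≤p*k) (length-parts k p L))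

    length-sequence : length sequence ≡ 2 * α + 2
    length-sequence = begin
      length (replicate q -1ₙ ++ map [f] ℓs)           ≡⟨ length-++ (replicate q -1ₙ) ⟩
      length (replicate q -1ₙ) + length (map [f] ℓs)   ≡⟨ cong₂ _+_ (length-replicate q) (trans (length-map [f] ℓs) (length-parts k p L)) ⟩
      q + p                                            ≡⟨ q+p≡2α+2 ⟩
      2 * α + 2                                        ∎
      where open ≡-Reasoning

    sequence-⊆-S : All S sequence
    sequence-⊆-S = ++⁺ (replicate⁺ q (0 , z≤n , inj₂ refl)) (map⁺ (All.map (λ {ℓ} ℓ≤k → ℓ , ℓ≤k , inj₁ refl) (parts-≤ k p L)))

    q<n : q < n
    q<n = begin-strict
      q              ≤⟨ q≤2α ⟩
      2 * α          ≡⟨ *-identityʳ (2 * α) ⟨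
      2 * α * 1      ≤⟨ *-monoʳ-≤ (2 * α) 1≤L ⟩
      2 * α * L      ≤⟨ m≤m+n (2 * α * L) p ⟩
      weight L p     <⟨ weight<n ⟩
      n              ∎
      where open ≤-Reasoning

    head-above-q : All (q <_) (take 1 (map f ℓs))
    head-above-q with p | L≤p*k
    ... | zero  | L≤0 = ⊥-elim (<⇒≱ 1≤L L≤0)
    ... | suc _ | _   = (begin-strict
      q                   ≤⟨ q≤2α ⟩
      2 * α               ≡⟨ *-identityʳ (2 * α) ⟨
      2 * α * 1           ≤⟨ *-monoʳ-≤ (2 * α) (⊓-glb 1≤L 1≤k) ⟩
      2 * α * (L ⊓ k)     <⟨ m<m+n _ (s≤s z≤n) ⟩
      2 * α * (L ⊓ k) + 1 ∎) ∷ []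
      where open ≤-Reasoning

    sequence-NoZeroBlock : NoZeroBlock sequence
    sequence-NoZeroBlock = NoDivisibleBlock⇒NoZeroBlock sequence (subst NoDivisibleBlock (sym toℕ-sequence)
      (minusOnes++-NoDivisibleBlock q (map f ℓs) q<n f-positive (subst (_< n) (sym sum-map-f-ℓs) weight<n) head-above-q))
      where
      f-positive : All (1 ≤_) (map f ℓs)
      f-positive = map⁺ (All.universal (λ ℓ → m≤n+m 1 (2 * α * ℓ)) ℓs)

    toℕ-sum-sequence : toℕ (sumₙ sequence) ≡ T
    toℕ-sum-sequence = begin
      toℕ (sumₙ sequence)                                ≡⟨ toℕ-sumₙ sequence ⟩
      sum (map toℕ sequence) % n                         ≡⟨ cong (λ z → sum z % n) toℕ-sequence ⟩
      sum (replicate q n' ++ map f ℓs) % n               ≡⟨ cong (_% n) (sum-++ (replicate q n') (map f ℓs)) ⟩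
      (sum (replicate q n') + sum (map f ℓs)) % n        ≡⟨ cong₂ (λ a b → (a + b) % n) (sum-replicate q n') (trans sum-map-f-ℓs weight≡T+q) ⟩
      (q * n' + (T + q)) % n                             ≡⟨ cong (_% n) (regroup q n' T) ⟩
      (T + q * n) % n                                    ≡⟨ [m+kn]%n≡m%n T q n ⟩
      T % n                                              ≡⟨ m<n⇒m%n≡m T<n ⟩
      T                                                  ∎
      where
      open ≡-Reasoning
      regroup : ∀ q n' T → q * n' + (T + q) ≡ T + q * suc n'
      regroup = solve-∀
      T<n : T < n
      T<n = ≤-<-trans (m≤m+n T q) (subst (_< n) weight≡T+q weight<n)

    ℛ-blueprint : ∀ y → toℕ y ≡ T → ℛ (2 * α + 2) S y
    ℛ-blueprint y y≡T = sequence , length-sequence , sequence-⊆-S , sequence-NoZeroBlock , toℕ-injective (trans toℕ-sum-sequence (sym y≡T))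

open Setting using (Blueprint; mkBlueprint)

small-blueprint : ∀ α k d e L → α ≡ suc (d + e) → L + 1 ≤ (3 + d) * k → Blueprint α k (2 * (2 + (d + L * α)))
small-blueprint α k d e L refl L+1≤ =
  mkBlueprint (3 + d) (α + e) (L + 1) (q+p≡ d e) (≤-via (suc d) (q+1+d≡2α d e)) (m≤n+m 1 L) L+1≤ (weight≡ d e L) weight<n
  where
  q+p≡ : ∀ d e → suc (d + e) + e + (3 + d) ≡ 2 * suc (d + e) + 2
  q+p≡ = solve-∀
  q+1+d≡2α : ∀ d e → suc (d + e) + e + suc d ≡ 2 * suc (d + e)
  q+1+d≡2α = solve-∀
  weight≡ : ∀ d e L → 2 * suc (d + e) * (L + 1) + (3 + d) ≡ 2 * (2 + (d + L * suc (d + e))) + (suc (d + e) + e)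
  weight≡ = solve-∀
  weight<n : 2 * α * (L + 1) + (3 + d) < suc (2 * α * (α + 4) * k + 2 * α + 4)
  weight<n = begin-strict
    2 * α * (L + 1) + (3 + d)            ≤⟨ +-monoˡ-≤ (3 + d) (*-monoʳ-≤ (2 * α) (≤-trans L+1≤ (*-monoˡ-≤ k 3+d≤α+4))) ⟩
    2 * α * ((α + 4) * k) + (3 + d)      <⟨ ≤-via (α + 2 + e) (gap d e k) ⟩
    suc (2 * α * (α + 4) * k + 2 * α + 4) ∎
    where
    open ≤-Reasoning
    3+d≤α+4 : 3 + d ≤ α + 4
    3+d≤α+4 = ≤-via (2 + e) (gap d e)
      where
      gap : ∀ d e → 3 + d + (2 + e) ≡ suc (d + e) + 4
      gap = solve-∀
    gap : ∀ d e k → let α = suc (d + e) in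
          suc (2 * α * ((α + 4) * k) + (3 + d)) + (α + 2 + e) ≡ suc (2 * α * (α + 4) * k + 2 * α + 4)
    gap = solve-∀

big-blueprint : ∀ α k d e L → α ≡ suc (d + e) → 1 ≤ k → (3 + d) * k ≤ L → L ≤ (α + 4) * k → L ≤ (α + 3 + d) * k →
  Blueprint α k (2 * (2 + (d + L * α)))
big-blueprint α k d e L refl 1≤k [3+d]k≤L L≤[α+4]k L≤p*k =
  mkBlueprint (α + 3 + d) e L (q+p≡ d e) (≤-via (α + 1 + d) (q+α+1+d≡2α d e)) 1≤L L≤p*k (weight≡ d e L) weight<n
  where
  q+p≡ : ∀ d e → e + (suc (d + e) + 3 + d) ≡ 2 * suc (d + e) + 2
  q+p≡ = solve-∀
  q+α+1+d≡2α : ∀ d e → e + (suc (d + e) + 1 + d) ≡ 2 * suc (d + e)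
  q+α+1+d≡2α = solve-∀
  weight≡ : ∀ d e L → 2 * suc (d + e) * L + (suc (d + e) + 3 + d) ≡ 2 * (2 + (d + L * suc (d + e))) + e
  weight≡ = solve-∀
  1≤L : 1 ≤ L
  1≤L = ≤-trans 1≤k (≤-trans (m≤m+n k _) [3+d]k≤L)
  weight<n : 2 * α * L + (α + 3 + d) < suc (2 * α * (α + 4) * k + 2 * α + 4)
  weight<n = begin-strict
    2 * α * L + (α + 3 + d)                 ≤⟨ +-monoˡ-≤ (α + 3 + d) (*-monoʳ-≤ (2 * α) L≤[α+4]k) ⟩
    2 * α * ((α + 4) * k) + (α + 3 + d)     <⟨ ≤-via (e + 2) (gap d e k) ⟩
    suc (2 * α * (α + 4) * k + 2 * α + 4)   ∎
    where
    open ≤-Reasoning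
    gap : ∀ d e k → let α = suc (d + e) in
          suc (2 * α * ((α + 4) * k) + (α + 3 + d)) + (e + 2) ≡ suc (2 * α * (α + 4) * k + 2 * α + 4)
    gap = solve-∀

≤-below-gap : ∀ {L K g} → L ≤ K + suc g → (∀ {ℓ} → ℓ ≤ g → L + ℓ ≢ K + suc g) → L ≤ K
≤-below-gap {L} {K} {g} L≤ excl with ≤-<-connex L K
... | inj₁ L≤K = L≤K
... | inj₂ K<L with m≤n⇒∃[o]m+o≡n K<L
...   | j , refl = ⊥-elim (excl (m∸n≤m g j) (begin
  suc K + j + (g ∸ j)    ≡⟨ +-assoc (suc K) j (g ∸ j) ⟩
  suc K + (j + (g ∸ j))  ≡⟨ cong (suc K +_) (m+[n∸m]≡n j≤g) ⟩
  suc K + g              ≡⟨ +-suc K g ⟨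
  K + suc g              ∎))
  where
  open ≡-Reasoning
  j≤g : j ≤ g
  j≤g = +-cancelˡ-≤ (suc K) j g (subst (suc K + j ≤_) (+-suc K g) L≤)

-- The hypotheses encode 2(2 + d + Lα) < n and, for d = 0, 2(2 + Lα) ∉ -S.
quotient-bounds : ∀ α k d L → 1 ≤ α → d + L * α ≤ suc ((α + 4) * k) * α →
  (d ≡ 0 → ∀ {ℓ} → ℓ ≤ k → L + ℓ ≢ (α + 3) * k + suc k) → L ≤ (α + 4) * k × L ≤ (α + 3 + d) * k
quotient-bounds α k zero L 1≤α bound excl =
  ≤-trans L≤[α+3]k (*-monoˡ-≤ k (+-monoʳ-≤ α (n≤1+n 3))) , subst (λ z → L ≤ z * k) (sym (+-identityʳ (α + 3))) L≤[α+3]k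
  where
  L≤[α+3]k : L ≤ (α + 3) * k
  L≤[α+3]k = ≤-below-gap (subst (L ≤_) (regroup α k) (*-cancelʳ-≤ L _ α {{>-nonZero 1≤α}} bound)) (excl refl)
    where
    regroup : ∀ α k → suc ((α + 4) * k) ≡ (α + 3) * k + suc k
    regroup = solve-∀
quotient-bounds α k (suc d) L 1≤α bound excl = L≤[α+4]k , ≤-trans L≤[α+4]k (*-monoˡ-≤ k (≤-via d (regroup α d)))
  where
  regroup : ∀ α d → α + 4 + d ≡ α + 3 + suc d
  regroup = solve-∀
  L≤[α+4]k : L ≤ (α + 4) * k
  L≤[α+4]k = ≤-pred (*-cancelʳ-< α L _ (≤-trans (s≤s (m≤n+m (L * α) d)) bound))

blueprint-from-quotient : ∀ α k d e L → α ≡ suc (d + e) → 1 ≤ α → 1 ≤ k → d + L * α ≤ suc ((α + 4) * k) * α →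
  (d ≡ 0 → ∀ {ℓ} → ℓ ≤ k → L + ℓ ≢ (α + 3) * k + suc k) → Blueprint α k (2 * (2 + (d + L * α)))
blueprint-from-quotient α k d e L α≡ 1≤α 1≤k bound excl with ≤-<-connex (L + 1) ((3 + d) * k)
... | inj₁ L+1≤ = small-blueprint α k d e L α≡ L+1≤
... | inj₂ <L+1 with quotient-bounds α k d L 1≤α bound excl
...   | L≤[α+4]k , L≤[α+3+d]k =
  big-blueprint α k d e L α≡ 1≤k (≤-pred (subst ((3 + d) * k <_) (+-comm L 1) <L+1)) L≤[α+4]k L≤[α+3+d]k

blueprint : ∀ α k h → 1 ≤ α → 1 ≤ k → 1 ≤ h → 2 * h < nOf α k →
  (∀ {ℓ} → ℓ ≤ k → 2 * h + Setting.f α k ℓ ≢ nOf α k) → Blueprint α k (2 * h)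
blueprint α k 1 1≤α 1≤k _ _ _ =
  mkBlueprint 2 (2 * α) 1 refl ≤-refl ≤-refl (≤-trans 1≤k (m≤m+n k _)) (regroup α) (≤-via (2 * α * (α + 4) * k + 2) (gap α k))
  where
  regroup : ∀ α → 2 * α * 1 + 2 ≡ 2 * 1 + 2 * α
  regroup = solve-∀
  gap : ∀ α k → suc (2 * α * 1 + 2) + (2 * α * (α + 4) * k + 2) ≡ suc (2 * α * (α + 4) * k + 2 * α + 4)
  gap = solve-∀
blueprint α k (suc (suc h₂)) 1≤α 1≤k _ 2h<n excl =
  subst (λ z → Blueprint α k (2 * (2 + z))) (sym h₂≡) (blueprint-from-quotient α k d e L α≡ 1≤α 1≤k bound excl₀)
  where
  instance
    α-nonZero : NonZero α
    α-nonZero = >-nonZero 1≤α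
  d L e : ℕ
  d = h₂ % α
  L = h₂ / α
  e = proj₁ (m≤n⇒∃[o]m+o≡n (m%n<n h₂ α))
  α≡ : α ≡ suc (d + e)
  α≡ = sym (proj₂ (m≤n⇒∃[o]m+o≡n (m%n<n h₂ α)))
  h₂≡ : h₂ ≡ d + L * α
  h₂≡ = m≡m%n+[m/n]*n h₂ α
  bound : d + L * α ≤ suc ((α + 4) * k) * α
  bound = subst (_≤ suc ((α + 4) * k) * α) h₂≡
    (+-cancelˡ-≤ 2 h₂ _ (*-cancelˡ-≤ 2 (subst (2 * (2 + h₂) ≤_) (regroup α k) (≤-pred 2h<n))))
    where
    regroup : ∀ α k → 2 * α * (α + 4) * k + 2 * α + 4 ≡ 2 * (2 + suc ((α + 4) * k) * α)
    regroup = solve-∀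
  excl₀ : d ≡ 0 → ∀ {ℓ} → ℓ ≤ k → L + ℓ ≢ (α + 3) * k + suc k
  excl₀ d≡0 {ℓ} ℓ≤k L+ℓ≡ = excl ℓ≤k (begin
    2 * (2 + h₂) + (2 * α * ℓ + 1)                ≡⟨ cong (λ z → 2 * (2 + z) + (2 * α * ℓ + 1)) (trans h₂≡ (cong (_+ L * α) d≡0)) ⟩
    2 * (2 + (0 + L * α)) + (2 * α * ℓ + 1)       ≡⟨ regroup α L ℓ ⟩
    5 + 2 * α * (L + ℓ)                           ≡⟨ cong (λ z → 5 + 2 * α * z) L+ℓ≡ ⟩
    5 + 2 * α * ((α + 3) * k + suc k)             ≡⟨ regroup' α k ⟩
    suc (2 * α * (α + 4) * k + 2 * α + 4)         ∎)
    where
    open ≡-Reasoning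
    regroup : ∀ α L ℓ → 2 * (2 + (0 + L * α)) + (2 * α * ℓ + 1) ≡ 5 + 2 * α * (L + ℓ)
    regroup = solve-∀
    regroup' : ∀ α k → 5 + 2 * α * ((α + 3) * k + suc k) ≡ suc (2 * α * (α + 4) * k + 2 * α + 4)
    regroup' = solve-∀

even-or-odd : ∀ m → Σ ℕ λ h → m ≡ 2 * h ⊎ m ≡ suc (2 * h)
even-or-odd zero    = 0 , inj₁ refl
even-or-odd (suc m) with even-or-odd m
... | h , inj₁ m≡2h = h , inj₂ (cong suc m≡2h)
... | h , inj₂ m≡2h+1 = suc h , inj₁ (trans (cong suc m≡2h+1) (sym (+-suc (suc h) (h + 0))))

module Characterisation (α k : ℕ) where

  open Setting α k
  open Residues n'
  open Zn n

  ℛ⇒∉S∪0 : ∀ {x} → ℛ (2 * α + 2) S x → ¬ S x × x ≢ 0ₙ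
  ℛ⇒∉S∪0 {x} (s , len , all , nz , sum≡x) = x∉S , x≢0
    where
    x∉S : ¬ S x
    x∉S x∈S = 0∉[2α+3]S ((-ₙ x) ∷ s , trans (cong suc len) (sym (+-suc (2 * α) 2)) , S-neg x x∈S ∷ all ,
      trans (cong ((-ₙ x) +ₙ_) sum≡x) (-ₙ-inverseˡ x))
    x≢0 : x ≢ 0ₙ
    x≢0 x≡0 = nz 0 (2 * α + 2) (m≤n+m 2 (2 * α)) (≤-reflexive (sym len))
      (trans (cong sumₙ (take-all (2 * α + 2) s (≤-reflexive len))) (trans sum≡x x≡0))

  ∉S∪0⇒ℛ-even : 1 ≤ α → 1 ≤ k → ∀ {y} h → toℕ y ≡ 2 * h → ¬ S y → y ≢ 0ₙ → ℛ (2 * α + 2) S y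
  ∉S∪0⇒ℛ-even 1≤α 1≤k zero y≡0 _ y≢0 = ⊥-elim (y≢0 (toℕ-injective y≡0))
  ∉S∪0⇒ℛ-even 1≤α 1≤k {y} (suc h) y≡2h y∉S _ =
    ℛ-blueprint 1≤k (blueprint α k (suc h) 1≤α 1≤k (s≤s z≤n) (subst (_< n) y≡2h (toℕ<n y)) y∉-S) y y≡2h
    where
    y∉-S : ∀ {ℓ} → ℓ ≤ k → 2 * suc h + f ℓ ≢ n
    y∉-S {ℓ} ℓ≤k 2h+fℓ≡n = y∉S (ℓ , ℓ≤k , inj₂ (toℕ-injective (+-cancelʳ-≡ (f ℓ) _ _
      (trans (cong (_+ f ℓ) y≡2h) (trans 2h+fℓ≡n (sym (toℕ-neg-[f] ℓ≤k)))))))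

  ∉S∪0⇒ℛ : 1 ≤ α → 1 ≤ k → ∀ {x} → ¬ S x → x ≢ 0ₙ → ℛ (2 * α + 2) S x
  ∉S∪0⇒ℛ 1≤α 1≤k {x} x∉S x≢0 with even-or-odd (toℕ x)
  ... | h , inj₁ x≡2h = ∉S∪0⇒ℛ-even 1≤α 1≤k h x≡2h x∉S x≢0
  ... | h , inj₂ x≡2h+1 = subst (ℛ (2 * α + 2) S) (-ₙ-involutive x) (ℛ-neg S-neg (∉S∪0⇒ℛ-even 1≤α 1≤k (c ∸ h) -x≡2[c∸h] -x∉S -x≢0))
    where
    c : ℕ
    c = α * (α + 4) * k + α + 2
    -x≡2[c∸h] : toℕ (-ₙ x) ≡ 2 * (c ∸ h)
    -x≡2[c∸h] = begin
      toℕ (-ₙ x)        ≡⟨ toℕ-neg x (subst (0 <_) (sym x≡2h+1) (s≤s z≤n)) ⟩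
      n ∸ toℕ x         ≡⟨ cong₂ _∸_ (cong suc (regroup α k)) x≡2h+1 ⟩
      2 * c ∸ 2 * h     ≡⟨ *-distribˡ-∸ 2 c h ⟨
      2 * (c ∸ h)       ∎
      where
      open ≡-Reasoning
      regroup : ∀ α k → 2 * α * (α + 4) * k + 2 * α + 4 ≡ 2 * (α * (α + 4) * k + α + 2)
      regroup = solve-∀
    -x∉S : ¬ S (-ₙ x)
    -x∉S -x∈S = x∉S (subst S (-ₙ-involutive x) (S-neg (-ₙ x) -x∈S))
    -x≢0 : -ₙ x ≢ 0ₙ
    -x≢0 -x≡0 = x≢0 (trans (sym (-ₙ-involutive x)) (trans (cong -ₙ_ -x≡0) -ₙ-zero))

theorem1p4 : (α k : ℕ) → 1 ≤ α → 1 ≤ k →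
    let n = nOf α k
        open Zn n
        S : Subset
        S x = Σ ℕ λ ℓ → ℓ ≤ k × ((x ≡ [ 2 * α * ℓ + 1 ] n) ⊎ (x ≡ -ₙ ([ 2 * α * ℓ + 1 ] n)))
    in ((x : Fin n) → ℛ (2 * α + 2) S x ⇔ (¬ S x × ¬ (x ≡ 0ₙ)))
       × ¬ ((2 * α + 3) · S) 0ₙ
theorem1p4 α k 1≤α 1≤k =
  (λ x → mk⇔ ℛ⇒∉S∪0 (λ (x∉S , x≢0) → ∉S∪0⇒ℛ 1≤α 1≤k x∉S x≢0)) , Setting.0∉[2α+3]S α k
  where open Characterisation α k
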